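{- If $Q$ is a quadruple system, then for any Kirkman triple system $K(Q)$ built from $Q$, $\chi(K(Q)) \geq \chi(Q)$.
   Context: A quadruple system of order $v$ is a set of $v$ points with a set of $4$-subsets (blocks) such that each pair of points lies in exactly one block. Given a quadruple system $Q$ on points $\{q_0,\dots,q_{v-1}\}$, a $K(Q)$ is a Kirkman triple system on $\{\infty\}\cup\{q_i,q_i' : 0\le i\le v-1\}$ obtained by placing, for each block $\{w,x,y,z\}$ of $Q$, the triples of a KTS$(9)$ on $\{\infty,w,x,y,z,w',x',y',z'\}$ so that the triples containing $\infty$ are $\{\infty,w,w'\},\{\infty,x,x'\},\{\infty,y,y'\},\{\infty,z,z'\}$ (the placement is not unique). A $\delta$-colouring of a design maps its points to $\delta$ colours with no monochromatic block; $\chi$ denotes the chromatic number, the least $\delta$ admitting a $\delta$-colouring. -}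

module Defs where

open import Data.Nat using (ℕ; _<_)
open import Data.Fin using (Fin; zero; suc; _↑ˡ_; _↑ʳ_)
open import Data.Product using (Σ; ∃; ∃-syntax; _×_; _,_; proj₁; proj₂)
open import Relation.Binary.PropositionalEquality using (_≡_; _≢_)
open import Relation.Nullary using (¬_)
open import Function using (_⇔_)
open import Function.Definitions using (Injective)

_∈B_ : {P : Set} {k : ℕ} → P → (Fin k → P) → Set
x ∈B blk = ∃[ t ] blk t ≡ x

SameSet : {P : Set} {k l : ℕ} → (Fin k → P) → (Fin l → P) → Set
SameSet {P} A B = (x : P) → (x ∈B A) ⇔ (x ∈B B)

-- every block is a k-subset (k distinct points), and every pair of
-- distinct points lies in exactly one block.  (Distinctness of blocks
-- follows from the uniqueness clause.)
IsPairwiseBalanced : {P : Set} {k b : ℕ} → (Fin b → Fin k → P) → Set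
IsPairwiseBalanced {P} {k} {b} B =
  ((i : Fin b) → Injective _≡_ _≡_ (B i)) ×
  ((x y : P) → x ≢ y →
     Σ (Fin b) λ i → (x ∈B B i) × (y ∈B B i) ×
       ((j : Fin b) → x ∈B B j → y ∈B B j → j ≡ i))

IsQuadrupleSystem : {v b : ℕ} → (Fin b → Fin 4 → Fin v) → Set
IsQuadrupleSystem Q = IsPairwiseBalanced Q

IsSTS : {P : Set} {b : ℕ} → (Fin b → Fin 3 → P) → Set
IsSTS T = IsPairwiseBalanced T

IsResolvable : {P : Set} {k b : ℕ} → (Fin b → Fin k → P) → Set
IsResolvable {P} {k} {b} B =
  Σ ℕ λ r → Σ (Fin b → Fin r) λ cls →
    (c : Fin r) (x : P) →
      Σ (Fin b) λ i → (cls i ≡ c) × (x ∈B B i) ×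
        ((j : Fin b) → cls j ≡ c → x ∈B B j → j ≡ i)

IsKTS : {P : Set} {b : ℕ} → (Fin b → Fin 3 → P) → Set
IsKTS T = IsSTS T × IsResolvable T

data KPt (v : ℕ) : Set where
  ∞   : KPt v
  pt  : Fin v → KPt v
  pt' : Fin v → KPt v

-- the 9 points of Fin 9 used for a KTS(9) placed on block {w,x,y,z}:
-- 0 ↦ ∞ ,  1+t ↦ (t-th point of the block) ,  5+t ↦ its primed copy
embed9 : {v : ℕ} → (Fin 4 → Fin v) → Fin 9 → KPt v
embed9 blk zero = ∞
embed9 blk (suc zero) = pt (blk zero)
embed9 blk (suc (suc zero)) = pt (blk (suc zero))
embed9 blk (suc (suc (suc zero))) = pt (blk (suc (suc zero)))
embed9 blk (suc (suc (suc (suc zero)))) = pt (blk (suc (suc (suc zero))))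
embed9 blk (suc (suc (suc (suc (suc zero))))) = pt' (blk zero)
embed9 blk (suc (suc (suc (suc (suc (suc zero)))))) = pt' (blk (suc zero))
embed9 blk (suc (suc (suc (suc (suc (suc (suc zero))))))) = pt' (blk (suc (suc zero)))
embed9 blk (suc (suc (suc (suc (suc (suc (suc (suc zero)))))))) = pt' (blk (suc (suc (suc zero))))

-- the triple {∞, t-th point, its primed copy} in the Fin 9 labelling
infTriple : Fin 4 → Fin 3 → Fin 9
infTriple t zero = zero
infTriple t (suc zero) = suc t'
  where t' = t ↑ˡ 4
infTriple t (suc (suc zero)) = suc (4 ↑ʳ t)

IsPlacedKTS9 : {d : ℕ} → (Fin d → Fin 3 → Fin 9) → Set
IsPlacedKTS9 {d} D =
  IsKTS D ×
  ((j : Fin d) → zero ∈B D j → ∃[ t ] SameSet (D j) (infTriple t))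

-- K is a K(Q): a Kirkman triple system on {∞} ∪ {q_i, q_i'} whose set
-- of triples is the union, over the blocks of Q, of the triples of a
-- placed KTS(9) on {∞,w,x,y,z,w',x',y',z'}.
IsKofQ : {v b b' : ℕ} → (Fin b → Fin 4 → Fin v) → (Fin b' → Fin 3 → KPt v) → Set
IsKofQ {v} {b} {b'} Q K =
  IsKTS K ×
  Σ ((i : Fin b) → Σ ℕ λ d → Fin d → Fin 3 → Fin 9) λ D →
    ((i : Fin b) → IsPlacedKTS9 (proj₂ (D i))) ×
    ((k : Fin b') → Σ (Fin b) λ i → ∃[ j ]
        SameSet (K k) (λ s → embed9 (Q i) (proj₂ (D i) j s))) ×
    ((i : Fin b) (j : Fin (proj₁ (D i))) → ∃[ k ]
        SameSet (K k) (λ s → embed9 (Q i) (proj₂ (D i) j s)))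

Monochromatic : {P : Set} {k δ : ℕ} → (P → Fin δ) → (Fin k → P) → Set
Monochromatic c blk = ∀ s t → c (blk s) ≡ c (blk t)

IsColouring : {P : Set} {k b : ℕ} (δ : ℕ) → (Fin b → Fin k → P) → (P → Fin δ) → Set
IsColouring δ B c = ∀ i → ¬ Monochromatic c (B i)

HasColouring : {P : Set} {k b : ℕ} → (Fin b → Fin k → P) → ℕ → Set
HasColouring {P} B δ = Σ (P → Fin δ) λ c → IsColouring δ B c

IsChromaticNumber : {P : Set} {k b : ℕ} → (Fin b → Fin k → P) → ℕ → Set
IsChromaticNumber B χ = HasColouring B χ × ((δ : ℕ) → δ < χ → ¬ HasColouring B δ)

-- Each placed KTS(9) has a triple inside the unprimed points {w,x,y,z}; otherwise each of the six
-- pairs of unprimed points would lie on a triple with a primed third point q′ c, and a primed point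
-- can serve only one such pair (two of them would force four points onto one triple), but there are
-- only four primed points.  Hence every block of Q contains a triple of K(Q) on its unprimed copies,
-- and a colouring of K(Q) restricted to the points q_i is a colouring of Q.
module Submission where

open import Defs
open import Data.Nat using (ℕ; _≤_; s≤s)
open import Data.Nat.Properties using (≮⇒≥)
open import Data.Fin using (Fin; zero; suc; _↑ˡ_; _↑ʳ_)
open import Data.Fin.Properties using (_≟_; any?; all?; ¬∀⟶∃¬; injective⇒≤; ↑ˡ-injective; suc-injective)
open import Data.Product using (∃-syntax; _×_; _,_; proj₁; proj₂)
open import Data.Sum using (_⊎_; inj₁; inj₂; [_,_])
open import Data.Empty using (⊥-elim)
open import Function using (_∘_; Equivalence)
open import Function.Definitions using (Injective)
open import Relation.Nullary using (¬_; Dec; yes; no; ¬?)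
open import Relation.Nullary.Decidable using (_×-dec_; _⊎-dec_; _→-dec_; toWitness)
open import Relation.Unary using (Decidable)
open import Relation.Binary.PropositionalEquality using (_≡_; _≢_; refl; sym; trans; cong; subst)

module _ {P : Set} where

  ∈B-to : ∀ {k l} {A : Fin k → P} {B : Fin l → P} → SameSet A B → ∀ {x} → x ∈B A → x ∈B B
  ∈B-to A≈B {x} = Equivalence.to (A≈B x)

  ∈B-from : ∀ {k l} {A : Fin k → P} {B : Fin l → P} → SameSet A B → ∀ {x} → x ∈B B → x ∈B A
  ∈B-from A≈B {x} = Equivalence.from (A≈B x)

  injection-into-block⇒≤ : ∀ {k n} (blk : Fin k → P) {f : Fin n → P} → Injective _≡_ _≡_ f →
    (∀ x → f x ∈B blk) → n ≤ k
  injection-into-block⇒≤ {k} {n} blk f-inj f⊆blk = injective⇒≤ {f = position} position-injective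
    where
    position : Fin n → Fin k
    position x = proj₁ (f⊆blk x)
    position-injective : Injective _≡_ _≡_ position
    position-injective {x} {y} eq =
      f-inj (trans (sym (proj₂ (f⊆blk x))) (trans (cong blk eq) (proj₂ (f⊆blk y))))

  pairwiseBalanced-unique : ∀ {k b} {B : Fin b → Fin k → P} → IsPairwiseBalanced B →
    ∀ {x y i j} → x ≢ y → x ∈B B i → y ∈B B i → x ∈B B j → y ∈B B j → i ≡ j
  pairwiseBalanced-unique (_ , balanced) {x} {y} {i} {j} x≢y x∈i y∈i x∈j y∈j =
    let (_ , _ , _ , unique) = balanced x y x≢y in trans (unique i x∈i y∈i) (sym (unique j x∈j y∈j))

  colouring-pullback : ∀ {P′ : Set} {k l a b δ} {A : Fin a → Fin k → P} {B : Fin b → Fin l → P′}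
    (f : P → P′) → (∀ i → ∃[ j ] ∀ s → ∃[ t ] B j s ≡ f (A i t)) →
    HasColouring B δ → HasColouring A δ
  colouring-pullback {A = A} f covered (c , proper) = c ∘ f , improper
    where
    improper : ∀ i → ¬ Monochromatic (c ∘ f) (A i)
    improper i mono with covered i
    ... | j , pick = proper j λ s s′ →
      trans (cong c (proj₂ (pick s))) (trans (mono _ _) (cong c (sym (proj₂ (pick s′)))))

chromaticNumber-≤ : ∀ {P : Set} {k b χ δ} {B : Fin b → Fin k → P} →
  IsChromaticNumber B χ → HasColouring B δ → χ ≤ δ
chromaticNumber-≤ {δ = δ} (_ , minimal) colouring = ≮⇒≥ λ δ<χ → minimal δ δ<χ colouring

edge : Fin 6 → Fin 4 × Fin 4
edge zero = zero , suc zero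
edge (suc zero) = zero , suc (suc zero)
edge (suc (suc zero)) = zero , suc (suc (suc zero))
edge (suc (suc (suc zero))) = suc zero , suc (suc zero)
edge (suc (suc (suc (suc zero)))) = suc zero , suc (suc (suc zero))
edge (suc (suc (suc (suc (suc zero))))) = suc (suc zero) , suc (suc (suc zero))

edge-proper : ∀ e → proj₁ (edge e) ≢ proj₂ (edge e)
edge-proper zero = λ ()
edge-proper (suc zero) = λ ()
edge-proper (suc (suc zero)) = λ ()
edge-proper (suc (suc (suc zero))) = λ ()
edge-proper (suc (suc (suc (suc zero)))) = λ ()
edge-proper (suc (suc (suc (suc (suc zero))))) = λ ()

_∈ₑ_ : Fin 4 → Fin 6 → Set
x ∈ₑ e = x ≡ proj₁ (edge e) ⊎ x ≡ proj₂ (edge e)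

_∈ₑ?_ : (x : Fin 4) (e : Fin 6) → Dec (x ∈ₑ e)
x ∈ₑ? e = (x ≟ proj₁ (edge e)) ⊎-dec (x ≟ proj₂ (edge e))

-- Two distinct edges avoiding c are two of the three edges of the triangle Fin 4 ∖ {c}.  Both facts
-- are checked exhaustively; abstract stops later unification from unfolding the decision procedure.
abstract
  edges-avoiding-meet : ∀ e e′ c → e ≢ e′ → ¬ c ∈ₑ e → ¬ c ∈ₑ e′ → ∃[ s ] s ∈ₑ e × s ∈ₑ e′
  edges-avoiding-meet = toWitness {a? = all? λ e → all? λ e′ → all? λ c →
    ¬? (e ≟ e′) →-dec ¬? (c ∈ₑ? e) →-dec ¬? (c ∈ₑ? e′) →-dec
    any? (λ s → s ∈ₑ? e ×-dec s ∈ₑ? e′)} _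

  edges-avoiding-cover : ∀ e e′ c → e ≢ e′ → ¬ c ∈ₑ e → ¬ c ∈ₑ e′ → ∀ x → x ≢ c → x ∈ₑ e ⊎ x ∈ₑ e′
  edges-avoiding-cover = toWitness {a? = all? λ e → all? λ e′ → all? λ c →
    ¬? (e ≟ e′) →-dec ¬? (c ∈ₑ? e) →-dec ¬? (c ∈ₑ? e′) →-dec
    all? (λ x → ¬? (x ≟ c) →-dec (x ∈ₑ? e ⊎-dec x ∈ₑ? e′))} _

-- In the labelling of embed9, position q t carries the t-th point of the block and q′ t its copy.
q q′ : Fin 4 → Fin 9
q t = suc (t ↑ˡ 4)
q′ t = suc (4 ↑ʳ t)

q-primedAt : Fin 4 → Fin 4 → Fin 9
q-primedAt c x with x ≟ c
... | yes _ = q′ c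
... | no _ = q x

q-injective : Injective _≡_ _≡_ q
q-injective {a} {b} = ↑ˡ-injective 4 a b ∘ suc-injective

q≢q′ : ∀ a b → q a ≢ q′ b
q≢q′ zero b ()
q≢q′ (suc zero) b ()
q≢q′ (suc (suc zero)) b ()
q≢q′ (suc (suc (suc zero))) b ()

q-primedAt-injective : ∀ c → Injective _≡_ _≡_ (q-primedAt c)
q-primedAt-injective c {x} {y} eq with x ≟ c | y ≟ c
... | yes refl | yes refl = refl
... | yes _ | no _ = ⊥-elim (q≢q′ y c (sym eq))
... | no _ | yes _ = ⊥-elim (q≢q′ x c eq)
... | no _ | no _ = q-injective eq

data Label : Fin 9 → Set where
  at∞  : Label zero
  atq  : ∀ t → Label (q t)
  atq′ : ∀ t → Label (q′ t)

label : ∀ x → Label x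
label zero = at∞
label (suc zero) = atq zero
label (suc (suc zero)) = atq (suc zero)
label (suc (suc (suc zero))) = atq (suc (suc zero))
label (suc (suc (suc (suc zero)))) = atq (suc (suc (suc zero)))
label (suc (suc (suc (suc (suc zero))))) = atq′ zero
label (suc (suc (suc (suc (suc (suc zero)))))) = atq′ (suc zero)
label (suc (suc (suc (suc (suc (suc (suc zero))))))) = atq′ (suc (suc zero))
label (suc (suc (suc (suc (suc (suc (suc (suc zero)))))))) = atq′ (suc (suc (suc zero)))

Unprimed : Fin 9 → Set
Unprimed x = ∃[ t ] x ≡ q t

unprimed? : Decidable Unprimed
unprimed? x with label x
... | at∞ = no λ ()
... | atq t = yes (t , refl)
... | atq′ t = no λ (u , eq) → q≢q′ u t (sym eq)

embed9-q : ∀ {v} (blk : Fin 4 → Fin v) t → embed9 blk (q t) ≡ pt (blk t)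
embed9-q blk zero = refl
embed9-q blk (suc zero) = refl
embed9-q blk (suc (suc zero)) = refl
embed9-q blk (suc (suc (suc zero))) = refl

q∈infTriple⇒≡ : ∀ {a t} → q a ∈B infTriple t → a ≡ t
q∈infTriple⇒≡ (suc zero , eq) = sym (q-injective eq)
q∈infTriple⇒≡ {a} {t} (suc (suc zero) , eq) = ⊥-elim (q≢q′ a t (sym eq))

module PlacedKTS9 {d} (D : Fin d → Fin 3 → Fin 9) (placed : IsPlacedKTS9 D) where

  balanced : IsPairwiseBalanced D
  balanced = proj₁ (proj₁ placed)

  ∞-block-meets-q-once : ∀ {j a b} → zero ∈B D j → q a ∈B D j → q b ∈B D j → a ≡ b
  ∞-block-meets-q-once {j} ∞∈ a∈ b∈ =
    let (_ , D≈) = proj₂ placed j ∞∈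
    in trans (q∈infTriple⇒≡ (∈B-to D≈ a∈)) (sym (q∈infTriple⇒≡ (∈B-to D≈ b∈)))

  q-q′-block-contains-∞ : ∀ {j a} → q a ∈B D j → q′ a ∈B D j → zero ∈B D j
  q-q′-block-contains-∞ {a = a} a∈ a′∈ with proj₂ balanced zero (q a) (λ ())
  ... | j₀ , ∞∈ , a∈₀ , _ with proj₂ placed j₀ ∞∈
  ... | t , D≈ with q∈infTriple⇒≡ (∈B-to D≈ a∈₀)
  ... | refl = subst (λ i → zero ∈B D i)
    (pairwiseBalanced-unique balanced (q≢q′ a a) a∈₀ (∈B-from D≈ (suc (suc zero) , refl)) a∈ a′∈) ∞∈

  UnprimedBlock : Set
  UnprimedBlock = ∃[ j ] ∀ s → Unprimed (D j s)

  record PrimedThird (e : Fin 6) : Set where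
    field
      third   : Fin 4
      avoids  : ¬ third ∈ₑ e
      block   : Fin d
      edge⊆   : ∀ x → x ∈ₑ e → q x ∈B D block
      third∈  : q′ third ∈B D block

  primed-third : ¬ UnprimedBlock → ∀ e → PrimedThird e
  primed-third none e
    with proj₂ balanced (q (proj₁ (edge e))) (q (proj₂ (edge e))) (edge-proper e ∘ q-injective)
  ... | j , a∈ , b∈ , _ with ¬∀⟶∃¬ 3 _ (unprimed? ∘ D j) (λ all → none (j , all))
  ... | s , not-q = classify (D j s) (s , refl) not-q
    where
    edge⊆ : ∀ x → x ∈ₑ e → q x ∈B D j
    edge⊆ x = [ (λ { refl → a∈ }) , (λ { refl → b∈ }) ]
    classify : ∀ x → x ∈B D j → ¬ Unprimed x → PrimedThird e
    classify x x∈ not-q with label x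
    ... | at∞ = ⊥-elim (edge-proper e (∞-block-meets-q-once x∈ a∈ b∈))
    ... | atq t = ⊥-elim (not-q (t , refl))
    ... | atq′ c = record { third = c ; avoids = avoids ; block = j ; edge⊆ = edge⊆ ; third∈ = x∈ }
      where
      avoids : ¬ c ∈ₑ e
      avoids c∈ = edge-proper e (∞-block-meets-q-once (q-q′-block-contains-∞ (edge⊆ c c∈) x∈) a∈ b∈)

  -- Two such triples through the same q′ c meet in some q s, so they coincide and contain
  -- all of Fin 4 ∖ {c} besides q′ c: four points on a triple.
  primed-thirds-differ : ∀ {e e′} → e ≢ e′ → (T : PrimedThird e) (T′ : PrimedThird e′) →
    PrimedThird.third T ≢ PrimedThird.third T′
  primed-thirds-differ {e} {e′} e≢e′ T T′ refl =
    ⊥-elim (4≰3 (injection-into-block⇒≤ (D j) (q-primedAt-injective c) qc⊆j))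
    where
    open PrimedThird T renaming (third to c; block to j)
    open PrimedThird T′ using () renaming (avoids to c∉e′; block to j′; edge⊆ to e′⊆j′; third∈ to c∈j′)
    4≰3 : ¬ 4 ≤ 3
    4≰3 (s≤s (s≤s (s≤s ())))
    j≡j′ : j ≡ j′
    j≡j′ with edges-avoiding-meet e e′ c e≢e′ avoids c∉e′
    ... | s , s∈e , s∈e′ =
      pairwiseBalanced-unique balanced (q≢q′ s c) (edge⊆ s s∈e) third∈ (e′⊆j′ s s∈e′) c∈j′
    qc⊆j : ∀ x → q-primedAt c x ∈B D j
    qc⊆j x with x ≟ c
    ... | yes _ = third∈
    ... | no x≢c with edges-avoiding-cover e e′ c e≢e′ avoids c∉e′ x x≢c
    ...   | inj₁ x∈e = edge⊆ x x∈e
    ...   | inj₂ x∈e′ = subst (λ i → q x ∈B D i) (sym j≡j′) (e′⊆j′ x x∈e′)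

  unprimed-block : UnprimedBlock
  unprimed-block with any? (λ j → all? (unprimed? ∘ D j))
  ... | yes found = found
  ... | no none = ⊥-elim (6≰4 (injective⇒≤ third-injective))
    where
    6≰4 : ¬ 6 ≤ 4
    6≰4 (s≤s (s≤s (s≤s (s≤s ()))))
    third-of : Fin 6 → Fin 4
    third-of e = PrimedThird.third (primed-third none e)
    third-injective : Injective _≡_ _≡_ third-of
    third-injective {e} {e′} same with e ≟ e′
    ... | yes e≡e′ = e≡e′
    ... | no e≢e′ = ⊥-elim (primed-thirds-differ e≢e′ (primed-third none e) (primed-third none e′) same)

K-covers-Q : ∀ {v b b′} (Q : Fin b → Fin 4 → Fin v) (K : Fin b′ → Fin 3 → KPt v) → IsKofQ Q K →
  ∀ i → ∃[ k ] ∀ s → ∃[ t ] K k s ≡ pt (Q i t)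
K-covers-Q Q K (_ , D , placed , _ , cover) i
  with PlacedKTS9.unprimed-block (proj₂ (D i)) (placed i)
... | j , unprimed with cover i j
... | k , K≈ = k , λ s → unprimed-image (∈B-to K≈ (s , refl))
  where
  unprimed-image : ∀ {x} → x ∈B (embed9 (Q i) ∘ proj₂ (D i) j) → ∃[ t ] x ≡ pt (Q i t)
  unprimed-image (u , refl) with unprimed u
  ... | t , eq = t , trans (cong (embed9 (Q i)) eq) (embed9-q (Q i) t)

corollary6p2 : {v b b' : ℕ} (Q : Fin b → Fin 4 → Fin v) → IsQuadrupleSystem Q →
    (K : Fin b' → Fin 3 → KPt v) → IsKofQ Q K →
    (χQ χK : ℕ) → IsChromaticNumber Q χQ → IsChromaticNumber K χK → χQ ≤ χK
corollary6p2 Q _ K K-of-Q _ _ χ-Q χ-K =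
  chromaticNumber-≤ χ-Q (colouring-pullback pt (K-covers-Q Q K K-of-Q) (proj₁ χ-K))
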